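{- For all formulas $\Gamma\cup\{\varphi,\psi,\gamma\}$: $\Gamma,\varphi\lor\psi,\varphi\vdash_{\mathsf{R}'_{\mathrm{BK}}}\gamma$ and $\Gamma,\varphi\lor\psi,\psi\vdash_{\mathsf{R}'_{\mathrm{BK}}}\gamma$ if, and only if, $\Gamma,\varphi\lor\psi\vdash_{\mathsf{R}'_{\mathrm{BK}}}\gamma$.
   Context: Formulas are built from a countably infinite set of variables with binary $\land,\lor$ and unary $\neg$. Set-Fmla Hilbert systems: rule schemas $\gamma_1,\dots,\gamma_m/\varphi$ with all substitution instances; $\Gamma\vdash_{\mathsf R}\varphi$ iff some finite sequence ending in $\varphi$ has each member in $\Gamma$ or the conclusion of a rule instance whose premises occur earlier. The $\lor$-lifted version of a rule $\gamma_1,\dots,\gamma_m/\varphi$ is $s\lor\gamma_1,\dots,s\lor\gamma_m/s\lor\varphi$ with $s$ a variable not occurring in the rule. $\mathsf{R}'_{\mathrm{BK}}$ has rule schemas ($p,q,r$ distinct): (1$\star$) $p,\neg p/q$; (2) $p/\neg\neg p$; (3) $\neg\neg p/p$; (4) $p,q/p\land q$; (5) $\neg p,\neg q/\neg(p\land q)$; (6) $\neg p,q/\neg(p\land q)$; (7) $p,\neg q/\neg(p\land q)$; (8$\star$) $\neg(p\land q)/\neg p\lor p$; (9$\star$) $\neg(p\land q)/\neg q\lor q$; (10) $p\land q/p$; (11) $p\land q/q$; (12) $\neg p,\neg q/\neg(p\lor q)$; (13) $\neg(p\lor q)/\neg p$; (14) $\neg(p\lor q)/\neg q$; (15$\star$)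 $p\lor q/p\lor\neg p$; (16$\star$) $p\lor q/q\lor\neg q$; (17) $\neg p,q/p\lor q$; (18) $p,\neg q/p\lor q$; (19) $p,q/p\lor q$; (20) $p\lor q,\neg p/q$; (21) $p\lor(q\lor r)/(p\lor q)\lor r$; (22) $p\lor p/p$; (23) $p\lor q/q\lor p$; (24) $p\lor q,r/\neg p\lor r$; plus the $\lor$-lifted versions of all these except (1$\star$). -}

module Defs where

open import Data.Nat using (ℕ)
open import Data.List using (List; []; _∷_; map)
open import Data.List.Membership.Propositional using (_∈_)
open import Data.List.Relation.Unary.All using (All)
open import Data.Product using (Σ; _×_; _,_)
open import Data.Sum using (_⊎_)
open import Relation.Binary.PropositionalEquality using (_≡_)

infixr 6 _∧_
infixr 5 _∨_
data Formula : Set where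
  var : ℕ → Formula
  _∧_ : Formula → Formula → Formula
  _∨_ : Formula → Formula → Formula
  ¬_  : Formula → Formula

Subst : Set
Subst = ℕ → Formula

_[_] : Formula → Subst → Formula
var n   [ σ ] = σ n
(a ∧ b) [ σ ] = (a [ σ ]) ∧ (b [ σ ])
(a ∨ b) [ σ ] = (a [ σ ]) ∨ (b [ σ ])
(¬ a)   [ σ ] = ¬ (a [ σ ])

record Rule : Set where
  constructor _/_
  field
    premises   : List Formula
    conclusion : Formula
open Rule public

p q r s : Formula
p = var 0
q = var 1
r = var 2
s = var 3

data LiftableRule : Set where
  r2 r3 r4 r5 r6 r7 r8 r9 r10 r11 r12 r13 r14 r15 r16
    r17 r18 r19 r20 r21 r22 r23 r24 : LiftableRule

data BaseRule : Set where
  r1  : BaseRule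
  lif : LiftableRule → BaseRule

liftableRule : LiftableRule → Rule
liftableRule r2  = (p ∷ []) / (¬ ¬ p)
liftableRule r3  = ((¬ ¬ p) ∷ []) / p
liftableRule r4  = (p ∷ q ∷ []) / (p ∧ q)
liftableRule r5  = ((¬ p) ∷ (¬ q) ∷ []) / (¬ (p ∧ q))
liftableRule r6  = ((¬ p) ∷ q ∷ []) / (¬ (p ∧ q))
liftableRule r7  = (p ∷ (¬ q) ∷ []) / (¬ (p ∧ q))
liftableRule r8  = ((¬ (p ∧ q)) ∷ []) / ((¬ p) ∨ p)
liftableRule r9  = ((¬ (p ∧ q)) ∷ []) / ((¬ q) ∨ q)
liftableRule r10 = ((p ∧ q) ∷ []) / p
liftableRule r11 = ((p ∧ q) ∷ []) / q
liftableRule r12 = ((¬ p) ∷ (¬ q) ∷ []) / (¬ (p ∨ q))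
liftableRule r13 = ((¬ (p ∨ q)) ∷ []) / (¬ p)
liftableRule r14 = ((¬ (p ∨ q)) ∷ []) / (¬ q)
liftableRule r15 = ((p ∨ q) ∷ []) / (p ∨ (¬ p))
liftableRule r16 = ((p ∨ q) ∷ []) / (q ∨ (¬ q))
liftableRule r17 = ((¬ p) ∷ q ∷ []) / (p ∨ q)
liftableRule r18 = (p ∷ (¬ q) ∷ []) / (p ∨ q)
liftableRule r19 = (p ∷ q ∷ []) / (p ∨ q)
liftableRule r20 = ((p ∨ q) ∷ (¬ p) ∷ []) / q
liftableRule r21 = ((p ∨ (q ∨ r)) ∷ []) / ((p ∨ q) ∨ r)
liftableRule r22 = ((p ∨ p) ∷ []) / p
liftableRule r23 = ((p ∨ q) ∷ []) / (q ∨ p)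
liftableRule r24 = ((p ∨ q) ∷ r ∷ []) / ((¬ p) ∨ r)

baseRule : BaseRule → Rule
baseRule r1      = (p ∷ (¬ p) ∷ []) / q
baseRule (lif x) = liftableRule x

-- ∨-lifted version, with s = var 3 not occurring in any of rules (1)–(24).
lift : Rule → Rule
lift (ps / c) = map (s ∨_) ps / (s ∨ c)

data RBK : Set where
  base   : BaseRule → RBK
  lifted : LiftableRule → RBK

ruleOf : RBK → Rule
ruleOf (base b)   = baseRule b
ruleOf (lifted x) = lift (liftableRule x)

FSet : Set₁
FSet = Formula → Set

_,,_ : FSet → Formula → FSet
(Γ ,, φ) χ = Γ χ ⊎ χ ≡ φ
infixl 4 _,,_

Justified : FSet → List Formula → Formula → Set
Justified Γ prev φ =
  Γ φ ⊎ Σ RBK (λ ρ → Σ Subst (λ σ →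
          (conclusion (ruleOf ρ) [ σ ] ≡ φ)
          × All (λ γ → (γ [ σ ]) ∈ prev) (premises (ruleOf ρ))))

-- Derivation sequences, stored in reverse (head = last member).
data Deriv (Γ : FSet) : List Formula → Set where
  []   : Deriv Γ []
  step : ∀ {prev φ} → Deriv Γ prev → Justified Γ prev φ → Deriv Γ (φ ∷ prev)

_⊢_ : FSet → Formula → Set
Γ ⊢ φ = Σ (List Formula) (λ prev → Deriv Γ (φ ∷ prev))
infix 3 _⊢_

-- If b ∨ a and b ∨ ¬b are derivable from Δ, then every derivation from Δ ∪ {a}
-- can be disjoined with b, formula by formula: the lifted rules carry each step
-- over, the member a becomes b ∨ a, and members of Δ become b ∨ θ through (24)
-- and (3). Only explosion (1) has no lifted version; there, b ∨ χ and b ∨ ¬χ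
-- yield b outright via (18), (20) and (22). Applying this twice, first with
-- b = ψ to a derivation from Δ ∪ {φ} and then with b = γ to one from Δ ∪ {ψ},
-- where Δ = Γ ∪ {φ ∨ ψ}, gives the hard direction; the other is monotonicity.
module Submission where

open import Defs
open import Data.Product using (_×_)
open import Function.Bundles using (_⇔_)

open import Data.Empty using (⊥)
open import Data.Unit using (⊤)
open import Data.Nat using (suc)
open import Data.List using (List; []; _∷_; _++_)
open import Data.List.Membership.Propositional using (_∈_)
open import Data.List.Membership.Propositional.Properties using (∈-++⁺ˡ; ∈-++⁺ʳ)
open import Data.List.Relation.Unary.All as All using (All; []; _∷_)
open import Data.List.Relation.Unary.All.Properties using (map⁺; map⁻)
open import Data.List.Relation.Unary.Any using (here)
open import Data.Product using (Σ; _,_)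
open import Data.Sum using (_⊎_; inj₁; inj₂)
open import Function.Bundles using (mk⇔)
open import Relation.Binary.PropositionalEquality using (_≡_; refl; sym; cong; cong₂; subst)

⟨_,_,_,_⟩ : Formula → Formula → Formula → Formula → Subst
⟨ a , b , c , d ⟩ 0 = a
⟨ a , b , c , d ⟩ 1 = b
⟨ a , b , c , d ⟩ 2 = c
⟨ a , b , c , d ⟩ 3 = d
⟨ a , b , c , d ⟩ (suc (suc (suc (suc n)))) = var n

_[s≔_] : Subst → Formula → Subst
(σ [s≔ c ]) 3 = c
(σ [s≔ c ]) n = σ n

s-free : Formula → Set
s-free (var 3) = ⊥
s-free (var _) = ⊤
s-free (a ∧ b) = s-free a × s-free b
s-free (a ∨ b) = s-free a × s-free b
s-free (¬ a)   = s-free a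

[s≔]-s-free : ∀ σ c γ → s-free γ → γ [ σ [s≔ c ] ] ≡ γ [ σ ]
[s≔]-s-free σ c (var 0) _ = refl
[s≔]-s-free σ c (var 1) _ = refl
[s≔]-s-free σ c (var 2) _ = refl
[s≔]-s-free σ c (var (suc (suc (suc (suc n))))) _ = refl
[s≔]-s-free σ c (a ∧ b) (fa , fb) = cong₂ _∧_ ([s≔]-s-free σ c a fa) ([s≔]-s-free σ c b fb)
[s≔]-s-free σ c (a ∨ b) (fa , fb) = cong₂ _∨_ ([s≔]-s-free σ c a fa) ([s≔]-s-free σ c b fb)
[s≔]-s-free σ c (¬ a) fa = cong ¬_ ([s≔]-s-free σ c a fa)

liftableRule-s-free : ∀ x →
  All s-free (premises (liftableRule x)) × s-free (conclusion (liftableRule x))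
liftableRule-s-free r2  = _ ∷ [] , _
liftableRule-s-free r3  = _ ∷ [] , _
liftableRule-s-free r4  = _ ∷ _ ∷ [] , _
liftableRule-s-free r5  = _ ∷ _ ∷ [] , _
liftableRule-s-free r6  = _ ∷ _ ∷ [] , _
liftableRule-s-free r7  = _ ∷ _ ∷ [] , _
liftableRule-s-free r8  = _ ∷ [] , _
liftableRule-s-free r9  = _ ∷ [] , _
liftableRule-s-free r10 = _ ∷ [] , _
liftableRule-s-free r11 = _ ∷ [] , _
liftableRule-s-free r12 = _ ∷ _ ∷ [] , _
liftableRule-s-free r13 = _ ∷ [] , _
liftableRule-s-free r14 = _ ∷ [] , _
liftableRule-s-free r15 = _ ∷ [] , _
liftableRule-s-free r16 = _ ∷ [] , _
liftableRule-s-free r17 = _ ∷ _ ∷ [] , _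
liftableRule-s-free r18 = _ ∷ _ ∷ [] , _
liftableRule-s-free r19 = _ ∷ _ ∷ [] , _
liftableRule-s-free r20 = _ ∷ _ ∷ [] , _
liftableRule-s-free r21 = _ ∷ [] , _
liftableRule-s-free r22 = _ ∷ [] , _
liftableRule-s-free r23 = _ ∷ [] , _
liftableRule-s-free r24 = _ ∷ _ ∷ [] , _

module _ {Δ : FSet} where

  Justified-++ : ∀ {prev φ} L → Justified Δ prev φ → Justified Δ (prev ++ L) φ
  Justified-++ L (inj₁ h) = inj₁ h
  Justified-++ L (inj₂ (ρ , σ , eq , ms)) = inj₂ (ρ , σ , eq , All.map ∈-++⁺ˡ ms)

  Deriv-++ : ∀ {L M} → Deriv Δ L → Deriv Δ M → Deriv Δ (M ++ L)
  Deriv-++ d []         = d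
  Deriv-++ d (step e j) = step (Deriv-++ d e) (Justified-++ _ j)

  Deriv-merge : ∀ σ {ps} → All (λ γ → Δ ⊢ γ [ σ ]) ps →
    Σ (List Formula) (λ L → Deriv Δ L × All (λ γ → γ [ σ ] ∈ L) ps)
  Deriv-merge σ [] = [] , [] , []
  Deriv-merge σ {γ ∷ _} ((L₀ , d₀) ∷ ds) with Deriv-merge σ ds
  ... | L , d , ms = (γ [ σ ] ∷ L₀) ++ L , Deriv-++ d d₀ ,
        ∈-++⁺ˡ {ys = L} (here refl) ∷ All.map (∈-++⁺ʳ (γ [ σ ] ∷ L₀)) ms

  ⊢-rule : ∀ ρ σ → All (λ γ → Δ ⊢ γ [ σ ]) (premises (ruleOf ρ)) →
    Δ ⊢ conclusion (ruleOf ρ) [ σ ]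
  ⊢-rule ρ σ ds with Deriv-merge σ ds
  ... | L , d , ms = L , step d (inj₂ (ρ , σ , refl , ms))

  ⊢-hyp : ∀ {φ} → Δ φ → Δ ⊢ φ
  ⊢-hyp h = [] , step [] (inj₁ h)

  Deriv-⊢ : ∀ {Γ L} → (∀ {φ} → Γ φ → Δ ⊢ φ) → Deriv Γ L → All (Δ ⊢_) L
  Deriv-⊢ h [] = []
  Deriv-⊢ h (step d (inj₁ g)) = h g ∷ Deriv-⊢ h d
  Deriv-⊢ h (step d (inj₂ (ρ , σ , eq , ms))) =
    subst (Δ ⊢_) eq (⊢-rule ρ σ (All.map (All.lookup ih) ms)) ∷ ih
    where ih = Deriv-⊢ h d

  ⊢-trans : ∀ {Γ φ} → (∀ {χ} → Γ χ → Δ ⊢ χ) → Γ ⊢ φ → Δ ⊢ φ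
  ⊢-trans h (_ , d) = All.head (Deriv-⊢ h d)

  ⊢-cut : ∀ {a φ} → Δ ⊢ a → (Δ ,, a) ⊢ φ → Δ ⊢ φ
  ⊢-cut da = ⊢-trans λ { (inj₁ h) → ⊢-hyp h ; (inj₂ refl) → da }

  ∨-comm : ∀ {a b} → Δ ⊢ a ∨ b → Δ ⊢ b ∨ a
  ∨-comm {a} {b} d = ⊢-rule (base (lif r23)) ⟨ a , b , a , a ⟩ (d ∷ [])

  ∨-assocˡ : ∀ {a b c} → Δ ⊢ a ∨ (b ∨ c) → Δ ⊢ (a ∨ b) ∨ c
  ∨-assocˡ {a} {b} {c} d = ⊢-rule (base (lif r21)) ⟨ a , b , c , a ⟩ (d ∷ [])

  ∨-assocʳ : ∀ {a b c} → Δ ⊢ (a ∨ b) ∨ c → Δ ⊢ a ∨ (b ∨ c)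
  ∨-assocʳ d = ∨-comm (∨-assocˡ (∨-comm (∨-assocˡ (∨-comm d))))

  ∨-idem : ∀ {a} → Δ ⊢ a ∨ a → Δ ⊢ a
  ∨-idem {a} d = ⊢-rule (base (lif r22)) ⟨ a , a , a , a ⟩ (d ∷ [])

  ∨-excluded-middleʳ : ∀ {a b} → Δ ⊢ a ∨ b → Δ ⊢ b ∨ ¬ b
  ∨-excluded-middleʳ {a} {b} d = ⊢-rule (base (lif r16)) ⟨ a , b , a , a ⟩ (d ∷ [])

  ∨-introʳ : ∀ {b φ} → Δ ⊢ b ∨ ¬ b → Δ ⊢ φ → Δ ⊢ b ∨ φ
  ∨-introʳ {b} {φ} em dφ = ∨-comm φ∨b
    where
    ¬¬b∨φ : Δ ⊢ ¬ ¬ b ∨ φ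
    ¬¬b∨φ = ⊢-rule (base (lif r24)) ⟨ ¬ b , b , φ , φ ⟩ (∨-comm em ∷ dφ ∷ [])
    φ∨b : Δ ⊢ φ ∨ b
    φ∨b = ⊢-rule (lifted r3) ⟨ b , b , b , φ ⟩ (∨-comm ¬¬b∨φ ∷ [])

  ∨-explosionʳ : ∀ {b χ} → Δ ⊢ b ∨ ¬ b → Δ ⊢ b ∨ χ → Δ ⊢ b ∨ ¬ χ → Δ ⊢ b
  ∨-explosionʳ {b} {χ} em dχ d¬χ = ∨-idem b∨b
    where
    b∨χ∨b : Δ ⊢ b ∨ (χ ∨ b)
    b∨χ∨b = ⊢-rule (lifted r18) ⟨ χ , b , b , b ⟩ (dχ ∷ em ∷ [])
    b∨b : Δ ⊢ b ∨ b
    b∨b = ⊢-rule (lifted r20) ⟨ χ , b , b , b ⟩ (b∨χ∨b ∷ d¬χ ∷ [])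

  -- The lifted version of x at σ [s≔ c], which agrees with σ on x as s does not occur in x.
  ∨-liftableʳ : ∀ x σ c → All (λ γ → Δ ⊢ c ∨ γ [ σ ]) (premises (liftableRule x)) →
    Δ ⊢ c ∨ conclusion (liftableRule x) [ σ ]
  ∨-liftableʳ x σ c ds with liftableRule-s-free x
  ... | fps , fc = subst (λ φ → Δ ⊢ c ∨ φ) ([s≔]-s-free σ c (conclusion (liftableRule x)) fc)
        (⊢-rule (lifted x) (σ [s≔ c ]) (map⁺ (All.zipWith (λ {γ} → premise {γ}) (fps , ds))))
    where
    premise : ∀ {γ} → s-free γ × Δ ⊢ c ∨ γ [ σ ] → Δ ⊢ c ∨ γ [ σ [s≔ c ] ]
    premise {γ} (f , d) = subst (λ φ → Δ ⊢ c ∨ φ) (sym ([s≔]-s-free σ c γ f)) d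

  Deriv-∨ʳ : ∀ {a b L} → Δ ⊢ b ∨ ¬ b → Δ ⊢ b ∨ a → Deriv (Δ ,, a) L →
    Δ ⊢ b ⊎ All (λ φ → Δ ⊢ b ∨ φ) L
  Deriv-∨ʳ em ba [] = inj₂ []
  Deriv-∨ʳ {b = b} em ba (step d j) with Deriv-∨ʳ em ba d
  ... | inj₁ db = inj₁ db
  ... | inj₂ ih with j
  ...   | inj₁ (inj₁ h)   = inj₂ (∨-introʳ em (⊢-hyp h) ∷ ih)
  ...   | inj₁ (inj₂ refl) = inj₂ (ba ∷ ih)
  ...   | inj₂ (base r1 , _ , _ , m₁ ∷ m₂ ∷ []) =
          inj₁ (∨-explosionʳ em (All.lookup ih m₁) (All.lookup ih m₂))
  ...   | inj₂ (base (lif x) , σ , refl , ms) =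
          inj₂ (∨-liftableʳ x σ b (All.map (All.lookup ih) ms) ∷ ih)
  ...   | inj₂ (lifted x , σ , refl , ms) = -- re-lift with b ∨ σ 3 in place of σ 3
          inj₂ (∨-assocʳ (∨-liftableʳ x σ (b ∨ σ 3)
                  (All.map (λ m → ∨-assocˡ (All.lookup ih m)) (map⁻ ms))) ∷ ih)

  ⊢-∨ʳ : ∀ {a b φ} → Δ ⊢ b ∨ ¬ b → Δ ⊢ b ∨ a → (Δ ,, a) ⊢ φ → Δ ⊢ b ⊎ Δ ⊢ b ∨ φ
  ⊢-∨ʳ em ba (_ , d) with Deriv-∨ʳ em ba d
  ... | inj₁ db = inj₁ db
  ... | inj₂ ds = inj₂ (All.head ds)

⊢-weaken : ∀ {Δ a φ} → Δ ⊢ φ → (Δ ,, a) ⊢ φ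
⊢-weaken = ⊢-trans (λ h → ⊢-hyp (inj₁ h))

lemma4 : (Γ : FSet) (φ ψ γ : Formula) →
    ((Γ ,, (φ ∨ ψ) ,, φ ⊢ γ) × (Γ ,, (φ ∨ ψ) ,, ψ ⊢ γ)) ⇔ (Γ ,, (φ ∨ ψ) ⊢ γ)
lemma4 Γ φ ψ γ = mk⇔ cases (λ d → ⊢-weaken d , ⊢-weaken d)
  where
  φ∨ψ : Γ ,, (φ ∨ ψ) ⊢ φ ∨ ψ
  φ∨ψ = ⊢-hyp (inj₂ refl)

  cases : (Γ ,, (φ ∨ ψ) ,, φ ⊢ γ) × (Γ ,, (φ ∨ ψ) ,, ψ ⊢ γ) → Γ ,, (φ ∨ ψ) ⊢ γ
  cases (dφ , dψ) with ⊢-∨ʳ (∨-excluded-middleʳ φ∨ψ) (∨-comm φ∨ψ) dφ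
  ... | inj₁ ψ-holds = ⊢-cut ψ-holds dψ
  ... | inj₂ ψ∨γ with ⊢-∨ʳ (∨-excluded-middleʳ ψ∨γ) (∨-comm ψ∨γ) dψ
  ...   | inj₁ γ-holds = γ-holds
  ...   | inj₂ γ∨γ = ∨-idem γ∨γ
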